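{- Let $\Pi$ be a strongly antisymmetric linear $m$-scheme on $S\subseteq V$. Let $k\in[m]$, $A\in\Pi^{(k)}$ and $A'=\sigma_k(A)$. Suppose $m\ge 2k$ and $m>k+\log(|A|/|A'|)$. Then $\sigma_k$ maps $A$ bijectively onto $A'$; in particular $|A'|=|A|$.
   Context: Logarithms are base 2. $V$ is a finite-dimensional vector space over a finite field $\mathbb{F}$. $\sigma_k:V^k\to V$ is $(x_1,\dots,x_k)\mapsto x_1+\dots+x_k$. $\mathcal{M}_{k,k'}$ is the set of maps $V^k\to V^{k'}$, $(x_1,\dots,x_k)\mapsto(\sum_i c_{i,1}x_i,\dots,\sum_i c_{i,k'}x_i)$, $c_{i,j}\in\mathbb{F}$. A linear $m$-scheme on $S$ is $\Pi=\{\Pi^{(1)},\dots,\Pi^{(m)}\}$ with $\Pi^{(k)}$ a partition of $S^k$ such that for all $k,k'\in[m]$, $B\in\Pi^{(k)}$, $B'\in\Pi^{(k')}$, $\tau\in\mathcal{M}_{k,k'}$: (P1) $\tau(B)=B'$ or $\tau(B)\cap B'=\emptyset$; (P2) $\#\{x\in B:\tau(x)=y\}$ is constant for $y\in B'$. $\Pi$ is strongly antisymmetric if no nontrivial permutation of a block of any $\Pi^{(k)}$ is a composition of bijections $\tau|_{B}:B\to B'$ between blocks ($\tau\in\mathcal{M}_{k,k'}$) and their inverses. -}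

module Defs where

open import Data.Nat using (ℕ; zero; suc; _≤_)
open import Data.Bool using (Bool; true; false; _∧_; if_then_else_)
open import Data.List using (List; []; _∷_; [_]; concatMap)
open import Data.Nat.ListAction using (sum)
open import Data.Bool.ListAction using (any)
import Data.List as L
open import Data.List.Membership.Propositional using (_∈_)
open import Data.List.Relation.Unary.Unique.Propositional using (Unique)
open import Data.Vec using (Vec; []; _∷_; zipWith; replicate; tabulate; lookup; foldr)
import Data.Vec as V
open import Data.Vec.Relation.Unary.All using (All)
open import Data.Vec.Properties using (≡-dec)
open import Data.Product using (Σ; ∃; _×_; _,_)
open import Data.Sum using (_⊎_)
open import Relation.Nullary using (¬_)
open import Relation.Nullary.Decidable using (⌊_⌋)
open import Relation.Binary.Definitions using (DecidableEquality)
open import Relation.Binary.PropositionalEquality using (_≡_; _≢_)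
open import Algebra.Core using (Op₁; Op₂)
open import Algebra.Structures using (IsCommutativeRing)

record FiniteField : Set₁ where
  infixl 6 _+_
  infixl 7 _*_
  field
    Carrier : Set
    _+_ _*_ : Op₂ Carrier
    -_ : Op₁ Carrier
    0# 1# : Carrier
    isCommutativeRing : IsCommutativeRing _≡_ _+_ _*_ -_ 0# 1#
    0≢1 : 0# ≢ 1#
    inverse : ∀ x → x ≢ 0# → ∃ λ y → x * y ≡ 1#
    _≟_ : DecidableEquality Carrier
    elems : List Carrier
    complete : ∀ x → x ∈ elems
    unique : Unique elems

allVecs : {A : Set} → List A → (k : ℕ) → List (Vec A k)
allVecs xs zero = [ [] ]
allVecs xs (suc k) = concatMap (λ x → L.map (x ∷_) (allVecs xs k)) xs

-- Everything relative to a finite field F and V = F^n (an arbitrary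
-- finite-dimensional F-vector space, up to isomorphism).

module Over (F : FiniteField) (n : ℕ) where
  open FiniteField F

  Vsp : Set
  Vsp = Vec Carrier n

  infixl 6 _+ᵥ_
  _+ᵥ_ : Vsp → Vsp → Vsp
  _+ᵥ_ = zipWith _+_

  0ᵥ : Vsp
  0ᵥ = replicate n 0#

  _•_ : Carrier → Vsp → Vsp
  c • v = V.map (c *_) v

  _≟ᵥ_ : DecidableEquality Vsp
  _≟ᵥ_ = ≡-dec _≟_

  Tuple : ℕ → Set
  Tuple k = Vec Vsp k

  _≟ₜ_ : {k : ℕ} → DecidableEquality (Tuple k)
  _≟ₜ_ = ≡-dec _≟ᵥ_

  allV : List Vsp
  allV = allVecs elems n

  allT : (k : ℕ) → List (Tuple k)
  allT k = allVecs allV k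

  Subset : ℕ → Set
  Subset k = Tuple k → Bool

  card : (k : ℕ) → Subset k → ℕ
  card k B = sum (L.map (λ x → if B x then 1 else 0) (allT k))

  cardV : (Vsp → Bool) → ℕ
  cardV B = sum (L.map (λ x → if B x then 1 else 0) allV)

  σ : (k : ℕ) → Tuple k → Vsp
  σ k x = foldr (λ _ → Vsp) _+ᵥ_ 0ᵥ x

  σImage : (k : ℕ) → Subset k → Vsp → Bool
  σImage k A y = any (λ x → A x ∧ ⌊ σ k x ≟ᵥ y ⌋) (allT k)

  -- elements of M_{k,k'}: coefficient matrix c, c ! i ! j = c_{i,j}
  LinMap : ℕ → ℕ → Set
  LinMap k k' = Vec (Vec Carrier k') k

  apply : {k k' : ℕ} → LinMap k k' → Tuple k → Tuple k'
  apply {k} c x = tabulate (λ j →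
    foldr (λ _ → Vsp) _+ᵥ_ 0ᵥ (tabulate (λ i → lookup (lookup c i) j • lookup x i)))

  InRange : ℕ → ℕ → Set
  InRange m k = 1 ≤ k × k ≤ m

  MapsOnto : {k k' : ℕ} → LinMap k k' → Subset k → Subset k' → Set
  MapsOnto c B B' =
    (∀ x → B x ≡ true → B' (apply c x) ≡ true) ×
    (∀ y → B' y ≡ true → ∃ λ x → B x ≡ true × apply c x ≡ y)

  InjOn : {k : ℕ} {A : Set} → Subset k → (Tuple k → A) → Set
  InjOn B f = ∀ x y → B x ≡ true → B y ≡ true → f x ≡ f y → x ≡ y

  BijStep : {k k' : ℕ} → LinMap k k' → Subset k → Subset k' → Set
  BijStep c B B' = MapsOnto c B B' × InjOn B (apply c)

  fiber : {k k' : ℕ} → LinMap k k' → Subset k → Tuple k' → ℕ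
  fiber {k} c B y = card k (λ x → B x ∧ ⌊ apply c x ≟ₜ y ⌋)

  Scheme : Set
  Scheme = (k : ℕ) → List (Subset k)

  record IsLinearScheme (m : ℕ) (S : Vsp → Bool) (Π : Scheme) : Set where
    field
      block-nonempty : ∀ k → InRange m k → ∀ B → B ∈ Π k → ∃ λ x → B x ≡ true
      block-⊆ : ∀ k → InRange m k → ∀ B → B ∈ Π k →
        ∀ x → B x ≡ true → All (λ v → S v ≡ true) x
      cover : ∀ k → InRange m k → ∀ x → All (λ v → S v ≡ true) x →
        ∃ λ B → B ∈ Π k × B x ≡ true
      disjoint : ∀ k → InRange m k → ∀ B B' → B ∈ Π k → B' ∈ Π k →
        ∀ x → B x ≡ true → B' x ≡ true → ∀ y → B y ≡ B' y
      P1 : ∀ k k' → InRange m k → InRange m k' → ∀ B B' → B ∈ Π k → B' ∈ Π k' →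
        (c : LinMap k k') →
        MapsOnto c B B' ⊎ (∀ x → B x ≡ true → B' (apply c x) ≡ false)
      P2 : ∀ k k' → InRange m k → InRange m k' → ∀ B B' → B ∈ Π k → B' ∈ Π k' →
        (c : LinMap k k') → ∀ y y' → B' y ≡ true → B' y' ≡ true →
        fiber c B y ≡ fiber c B y'

  -- Reach m Π x y : y is the image of x under some composition of
  -- bijections τ|_B : B → B' between blocks (τ ∈ M_{k,k'}) and their inverses.
  data Reach (m : ℕ) (Π : Scheme) {k : ℕ} (x : Tuple k) : (k' : ℕ) → Tuple k' → Set where
    here : Reach m Π x k x
    fwd : ∀ {k₁ k₂} {y : Tuple k₁} → Reach m Π x k₁ y →
      InRange m k₁ → InRange m k₂ →
      (B : Subset k₁) (B' : Subset k₂) → B ∈ Π k₁ → B' ∈ Π k₂ →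
      (c : LinMap k₁ k₂) → BijStep c B B' → B y ≡ true →
      Reach m Π x k₂ (apply c y)
    bwd : ∀ {k₁ k₂} {y : Tuple k₂} → Reach m Π x k₂ y →
      InRange m k₁ → InRange m k₂ →
      (B : Subset k₁) (B' : Subset k₂) → B ∈ Π k₁ → B' ∈ Π k₂ →
      (c : LinMap k₁ k₂) → BijStep c B B' →
      (z : Tuple k₁) → B z ≡ true → apply c z ≡ y →
      Reach m Π x k₁ z

  -- every such composition mapping a block to itself is the identity
  StronglyAntisymmetric : (m : ℕ) → Scheme → Set
  StronglyAntisymmetric m Π = ∀ k → InRange m k → ∀ B → B ∈ Π k →
    ∀ x y → B x ≡ true → B y ≡ true → Reach m Π x k y → x ≡ y

{-# OPTIONS --safe #-}
-- Suppose σ_k identifies x ≠ u ∷ w in A. The block C of w ++ x ∈ V^(2k-1) is mapped into A both by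
-- dropping the first k-1 coordinates and by (w , x) ↦ (σ x − σ w) ∷ w. If the first map were injective
-- on C, counting with (P2) would make both maps bijections C → A, and composing one with the inverse of
-- the other would send x to u ∷ w inside A, against strong antisymmetry. Hence two elements of C lie
-- over x; at a coordinate where they differ they produce a block of V^(k+1) containing two tuples that
-- differ only in their head. For such a block every fiber of "drop the head" has at least 2^(m-k)
-- elements: by induction on the level, the tuples a ∷ b ∷ x and b ∷ a ∷ x lie in different blocks
-- (again by strong antisymmetry), and each of these blocks contributes 2^(m-k-1) elements. These fibers
-- inject into the fibers of σ_k on A, so |A| ≥ 2^(m-k) |σ_k(A)|, a contradiction.
module Submission where

open import Defs
open import Data.Nat
  using (ℕ; zero; suc; _+_; _*_; _^_; _∸_; _≤_; _<_; z≤n; s≤s; s≤s⁻¹; _≤?_; >-nonZero)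
open import Data.Nat.Properties
open import Data.Bool using (Bool; true; false; _∧_; _∨_; if_then_else_)
open import Data.Bool.ListAction using (any)
open import Data.Bool.Properties using () renaming (_≟_ to _≟ᵇ_)
open import Data.Nat.ListAction using (sum)
open import Data.List using (List; []; _∷_; concatMap)
import Data.List as L
open import Data.List.Membership.Propositional using (_∈_)
open import Data.List.Membership.Propositional.Properties
  using (∈-map⁺; ∈-map⁻; ∈-++⁺ˡ; ∈-++⁺ʳ; ∈-++⁻)
open import Data.List.Relation.Unary.Any using (here; there)
import Data.List.Relation.Unary.All as ListAll
open import Data.Vec.Relation.Unary.All using (All; _∷_)
import Data.Vec.Relation.Unary.All as All
open import Data.Vec.Relation.Unary.All.Properties using (lookup⁺) renaming (++⁺ to All-++⁺)
open import Data.List.Relation.Unary.AllPairs using ([]; _∷_)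
open import Data.List.Relation.Unary.Unique.Propositional using (Unique)
open import Data.List.Relation.Unary.Unique.Propositional.Properties using (map⁺; ++⁺)
open import Data.Vec using (Vec; []; _∷_; _++_; lookup; tabulate)
import Data.Vec as V
open import Data.Vec.Properties
  using (∷-injective; map-cong; map-id; map-const; tabulate-cong; lookup∘tabulate; tabulate∘lookup;
         lookup-++ˡ; lookup-++ʳ; zipWith-assoc; zipWith-comm; zipWith-identityˡ; zipWith-identityʳ;
         zipWith-inverseˡ)
open import Data.Fin using (Fin; zero; suc; _↑ˡ_; _↑ʳ_)
open import Algebra.Bundles using (CommutativeMonoid)
open import Algebra.Structures using (IsCommutativeRing; IsCommutativeMonoid)
import Algebra.Properties.CommutativeSemigroup as CommutativeSemigroupProperties
open import Data.Product using (∃; ∃₂; _×_; _,_; proj₁; proj₂)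
open import Data.Sum using (inj₁; inj₂)
open import Data.Empty using (⊥; ⊥-elim)
open import Relation.Nullary using (¬_; yes; no)
open import Relation.Nullary.Decidable using (⌊_⌋)
open import Relation.Binary.Definitions using (DecidableEquality)
open import Relation.Binary.PropositionalEquality

private
  variable
    X Y : Set

  module ℕ-+ = CommutativeSemigroupProperties +-commutativeSemigroup

m∸n≡1+[m∸1+n] : ∀ {m n} → n < m → m ∸ n ≡ suc (m ∸ suc n)
m∸n≡1+[m∸1+n] {suc m} {zero} _ = refl
m∸n≡1+[m∸1+n] {suc m} {suc n} (s≤s n<m) = m∸n≡1+[m∸1+n] n<m

module Counting where

  indicator : Bool → ℕ
  indicator b = if b then 1 else 0

  Σ-over : List X → (X → ℕ) → ℕ
  Σ-over xs f = sum (L.map f xs)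

  count : (X → Bool) → List X → ℕ
  count P xs = Σ-over xs (λ x → indicator (P x))

  Σ-over-+ : (xs : List X) (f g : X → ℕ) →
    Σ-over xs (λ x → f x + g x) ≡ Σ-over xs f + Σ-over xs g
  Σ-over-+ [] f g = refl
  Σ-over-+ (x ∷ xs) f g =
    trans (cong (f x + g x +_) (Σ-over-+ xs f g)) (ℕ-+.interchange (f x) (g x) _ _)

  Σ-over-cong : (xs : List X) {f g : X → ℕ} → (∀ x → x ∈ xs → f x ≡ g x) →
    Σ-over xs f ≡ Σ-over xs g
  Σ-over-cong [] f≗g = refl
  Σ-over-cong (x ∷ xs) f≗g =
    cong₂ _+_ (f≗g x (here refl)) (Σ-over-cong xs (λ y y∈ → f≗g y (there y∈)))

  Σ-over-mono-≤ : (xs : List X) {f g : X → ℕ} → (∀ x → x ∈ xs → f x ≤ g x) →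
    Σ-over xs f ≤ Σ-over xs g
  Σ-over-mono-≤ [] f≤g = z≤n
  Σ-over-mono-≤ (x ∷ xs) f≤g =
    +-mono-≤ (f≤g x (here refl)) (Σ-over-mono-≤ xs (λ y y∈ → f≤g y (there y∈)))

  Σ-over-*ˡ : (xs : List X) (c : ℕ) (f : X → ℕ) →
    Σ-over xs (λ x → c * f x) ≡ c * Σ-over xs f
  Σ-over-*ˡ [] c f = sym (*-zeroʳ c)
  Σ-over-*ˡ (x ∷ xs) c f =
    trans (cong (c * f x +_) (Σ-over-*ˡ xs c f)) (sym (*-distribˡ-+ c (f x) _))

  Σ-over-zero : (xs : List X) → Σ-over xs (λ _ → 0) ≡ 0
  Σ-over-zero [] = refl
  Σ-over-zero (x ∷ xs) = Σ-over-zero xs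

  Σ-over-swap : (xs : List X) (ys : List Y) (f : X → Y → ℕ) →
    Σ-over xs (λ x → Σ-over ys (f x)) ≡ Σ-over ys (λ y → Σ-over xs (λ x → f x y))
  Σ-over-swap [] ys f = sym (Σ-over-zero ys)
  Σ-over-swap (x ∷ xs) ys f =
    trans (cong (Σ-over ys (f x) +_) (Σ-over-swap xs ys f))
          (sym (Σ-over-+ ys (f x) (λ y → Σ-over xs (λ x' → f x' y))))

  indicator-∧ : ∀ a b → indicator (a ∧ b) ≡ indicator a * indicator b
  indicator-∧ true b = sym (+-identityʳ (indicator b))
  indicator-∧ false b = refl

  count-≡0 : (P : X → Bool) (xs : List X) → (∀ x → x ∈ xs → P x ≡ false) → count P xs ≡ 0
  count-≡0 P [] ¬P = refl
  count-≡0 P (x ∷ xs) ¬P rewrite ¬P x (here refl) = count-≡0 P xs (λ y y∈ → ¬P y (there y∈))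

  count-≥1 : (P : X → Bool) {xs : List X} {x : X} → x ∈ xs → P x ≡ true → 1 ≤ count P xs
  count-≥1 P (here refl) Px rewrite Px = s≤s z≤n
  count-≥1 P {y ∷ _} (there x∈) Px = ≤-trans (count-≥1 P x∈ Px) (m≤n+m _ (indicator (P y)))

  count-≥2 : (P : X → Bool) {xs : List X} {a b : X} → a ≢ b → a ∈ xs → b ∈ xs →
    P a ≡ true → P b ≡ true → 2 ≤ count P xs
  count-≥2 P a≢b (here refl) (here refl) Pa Pb = ⊥-elim (a≢b refl)
  count-≥2 P a≢b (here refl) (there b∈) Pa Pb rewrite Pa = s≤s (count-≥1 P b∈ Pb)
  count-≥2 P a≢b (there a∈) (here refl) Pa Pb rewrite Pb = s≤s (count-≥1 P a∈ Pa)
  count-≥2 P {y ∷ _} a≢b (there a∈) (there b∈) Pa Pb =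
    ≤-trans (count-≥2 P a≢b a∈ b∈ Pa Pb) (m≤n+m _ (indicator (P y)))

  count-≤1 : (P : X → Bool) {xs : List X} → Unique xs →
    (∀ a b → P a ≡ true → P b ≡ true → a ≡ b) → count P xs ≤ 1
  count-≤1 P [] P-unique = z≤n
  count-≤1 P {x ∷ xs} (x∉xs ∷ xs-unique) P-unique with P x in Px
  ... | false = count-≤1 P xs-unique P-unique
  ... | true = ≤-reflexive (cong suc (count-≡0 P xs ¬P))
    where
    ¬P : ∀ y → y ∈ xs → P y ≡ false
    ¬P y y∈ with P y in Py
    ... | false = refl
    ... | true = ⊥-elim (ListAll.lookup x∉xs y∈ (P-unique x y Px Py))

  count-≥1⇒∃ : (P : X → Bool) (xs : List X) → 1 ≤ count P xs → ∃ λ x → x ∈ xs × P x ≡ true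
  count-≥1⇒∃ P (x ∷ xs) 1≤ with P x in Px
  ... | true = x , here refl , Px
  ... | false with count-≥1⇒∃ P xs 1≤
  ...   | y , y∈ , Py = y , there y∈ , Py

  count-≥2⇒∃₂ : (P : X → Bool) {xs : List X} → Unique xs → 2 ≤ count P xs →
    ∃₂ λ a b → a ≢ b × P a ≡ true × P b ≡ true
  count-≥2⇒∃₂ P {x ∷ xs} (x∉xs ∷ xs-unique) 2≤ with P x in Px
  ... | false = count-≥2⇒∃₂ P xs-unique 2≤
  ... | true with count-≥1⇒∃ P xs (s≤s⁻¹ 2≤)
  ...   | y , y∈ , Py = x , y , (λ x≡y → ListAll.lookup x∉xs y∈ x≡y) , Px , Py

  count-∨ : (P Q : X → Bool) (xs : List X) → (∀ x → P x ≡ true → Q x ≡ true → ⊥) →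
    count P xs + count Q xs ≡ count (λ x → P x ∨ Q x) xs
  count-∨ P Q xs disjoint =
    trans (sym (Σ-over-+ xs _ _)) (Σ-over-cong xs (λ x _ → indicator-∨ x))
    where
    indicator-∨ : ∀ x → indicator (P x) + indicator (Q x) ≡ indicator (P x ∨ Q x)
    indicator-∨ x with P x in Px | Q x in Qx
    ... | true  | true  = ⊥-elim (disjoint x Px Qx)
    ... | true  | false = refl
    ... | false | _     = refl

  any-true⁺ : (P : X → Bool) {xs : List X} {x : X} → x ∈ xs → P x ≡ true → any P xs ≡ true
  any-true⁺ P (here refl) Px rewrite Px = refl
  any-true⁺ P {y ∷ _} (there x∈) Px with P y
  ... | true = refl
  ... | false = any-true⁺ P x∈ Px

  any-true⁻ : (P : X → Bool) (xs : List X) → any P xs ≡ true → ∃ λ x → x ∈ xs × P x ≡ true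
  any-true⁻ P (y ∷ xs) any≡ with P y in Py
  ... | true = y , here refl , Py
  ... | false with any-true⁻ P xs any≡
  ...   | x , x∈ , Px = x , there x∈ , Px

open Counting

-- With xs = allT k, the fiber c B y, card k B and σImage k A of Defs unfold to
-- fiber (apply c) B xs y, count B xs and image (σ k) A xs below.
module Enumerated {Y : Set} (_≟_ : DecidableEquality Y)
  (ys : List Y) (ys-unique : Unique ys) (ys-complete : ∀ y → y ∈ ys) where

  ≟-true⇒≡ : {a b : Y} → ⌊ a ≟ b ⌋ ≡ true → a ≡ b
  ≟-true⇒≡ {a} {b} _ with yes a≡b ← a ≟ b = a≡b

  ≡⇒≟-true : {a b : Y} → a ≡ b → ⌊ a ≟ b ⌋ ≡ true
  ≡⇒≟-true {a} {b} a≡b with a ≟ b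
  ... | yes _ = refl
  ... | no a≢b = ⊥-elim (a≢b a≡b)

  count-≟ : (y : Y) → count (λ y' → ⌊ y ≟ y' ⌋) ys ≡ 1
  count-≟ y = ≤-antisym
    (count-≤1 _ ys-unique (λ a b y≡a y≡b → trans (sym (≟-true⇒≡ y≡a)) (≟-true⇒≡ y≡b)))
    (count-≥1 _ (ys-complete y) (≡⇒≟-true refl))

  inFiber : (X → Y) → (X → Bool) → Y → X → Bool
  inFiber φ P y x = P x ∧ ⌊ φ x ≟ y ⌋

  fiber : (X → Y) → (X → Bool) → List X → Y → ℕ
  fiber φ P xs y = count (inFiber φ P y) xs

  image : (X → Y) → (X → Bool) → List X → Y → Bool
  image φ P xs y = any (inFiber φ P y) xs

  inFiber⁺ : (φ : X → Y) (P : X → Bool) {x : X} {y : Y} →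
    P x ≡ true → φ x ≡ y → inFiber φ P y x ≡ true
  inFiber⁺ φ P Px φx≡y rewrite Px = ≡⇒≟-true φx≡y

  inFiber⁻ : (φ : X → Y) (P : X → Bool) {x : X} {y : Y} →
    inFiber φ P y x ≡ true → P x ≡ true × φ x ≡ y
  inFiber⁻ φ P {x} x∈ with true ← P x = refl , ≟-true⇒≡ x∈

  count-≡-Σ-fiber : (xs : List X) (P : X → Bool) (φ : X → Y) →
    count P xs ≡ Σ-over ys (fiber φ P xs)
  count-≡-Σ-fiber xs P φ =
    trans (Σ-over-cong xs (λ x _ → indicator-≡-Σ x))
          (Σ-over-swap xs ys (λ x y → indicator (inFiber φ P y x)))
    where
    open ≡-Reasoning
    indicator-≡-Σ : ∀ x → indicator (P x) ≡ Σ-over ys (λ y → indicator (inFiber φ P y x))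
    indicator-≡-Σ x = begin
      indicator (P x)
        ≡⟨ *-identityʳ _ ⟨
      indicator (P x) * 1
        ≡⟨ cong (indicator (P x) *_) (count-≟ (φ x)) ⟨
      indicator (P x) * count (λ y → ⌊ φ x ≟ y ⌋) ys
        ≡⟨ Σ-over-*ˡ ys (indicator (P x)) _ ⟨
      Σ-over ys (λ y → indicator (P x) * indicator ⌊ φ x ≟ y ⌋)
        ≡⟨ Σ-over-cong ys (λ y _ → indicator-∧ (P x) _) ⟨
      Σ-over ys (λ y → indicator (inFiber φ P y x))
        ∎

  fiber-≡0 : {φ : X → Y} {P : X → Bool} {Q : Y → Bool} {y : Y} (xs : List X) →
    (∀ x → P x ≡ true → Q (φ x) ≡ true) → Q y ≡ false → fiber φ P xs y ≡ 0
  fiber-≡0 {φ = φ} {P = P} {y = y} xs P⇒Qφ Qy = count-≡0 _ xs outside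
    where
    outside : ∀ x → x ∈ xs → inFiber φ P y x ≡ false
    outside x _ with inFiber φ P y x in x∈
    ... | false = refl
    ... | true with inFiber⁻ φ P x∈
    ...   | Px , refl with () ← trans (sym (P⇒Qφ x Px)) Qy

  fiber-≤1 : {φ : X → Y} {P : X → Bool} {xs : List X} → Unique xs →
    (∀ a b → P a ≡ true → P b ≡ true → φ a ≡ φ b → a ≡ b) → ∀ y → fiber φ P xs y ≤ 1
  fiber-≤1 {φ = φ} {P = P} xs-unique φ-injective y = count-≤1 _ xs-unique λ a b a∈ b∈ →
    let Pa , φa≡y = inFiber⁻ φ P a∈ ; Pb , φb≡y = inFiber⁻ φ P b∈ in
    φ-injective a b Pa Pb (trans φa≡y (sym φb≡y))

  count-≡-*-of-fibers-≡ : (xs : List X) (P : X → Bool) (Q : Y → Bool) (φ : X → Y) (e : ℕ) →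
    (∀ x → P x ≡ true → Q (φ x) ≡ true) → (∀ y → Q y ≡ true → fiber φ P xs y ≡ e) →
    count P xs ≡ e * count Q ys
  count-≡-*-of-fibers-≡ xs P Q φ e P⇒Qφ fibers≡e =
    trans (count-≡-Σ-fiber xs P φ) (trans (Σ-over-cong ys (λ y _ → fiber-≡ y)) (Σ-over-*ˡ ys e _))
    where
    fiber-≡ : ∀ y → fiber φ P xs y ≡ e * indicator (Q y)
    fiber-≡ y with Q y in Qy
    ... | true = trans (fibers≡e y Qy) (sym (*-identityʳ e))
    ... | false = trans (fiber-≡0 xs P⇒Qφ Qy) (sym (*-zeroʳ e))

  count-≤-of-injective : (xs : List X) → Unique xs → (P : X → Bool) (Q : Y → Bool) (φ : X → Y) →
    (∀ x → P x ≡ true → Q (φ x) ≡ true) →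
    (∀ a b → P a ≡ true → P b ≡ true → φ a ≡ φ b → a ≡ b) →
    count P xs ≤ count Q ys
  count-≤-of-injective xs xs-unique P Q φ P⇒Qφ φ-injective =
    ≤-trans (≤-reflexive (count-≡-Σ-fiber xs P φ)) (Σ-over-mono-≤ ys (λ y _ → fiber-≤-indicator y))
    where
    fiber-≤-indicator : ∀ y → fiber φ P xs y ≤ indicator (Q y)
    fiber-≤-indicator y with Q y in Qy
    ... | true = fiber-≤1 xs-unique φ-injective y
    ... | false = ≤-reflexive (fiber-≡0 xs P⇒Qφ Qy)

  *-count-image-≤ : (xs : List X) (P : X → Bool) (φ : X → Y) (e : ℕ) →
    (∀ x → P x ≡ true → e ≤ fiber φ P xs (φ x)) →
    e * count (image φ P xs) ys ≤ count P xs
  *-count-image-≤ xs P φ e fibers-large = begin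
    e * count (image φ P xs) ys                 ≡⟨ Σ-over-*ˡ ys e _ ⟨
    Σ-over ys (λ y → e * indicator (image φ P xs y)) ≤⟨ Σ-over-mono-≤ ys (λ y _ → bound y) ⟩
    Σ-over ys (fiber φ P xs)                    ≡⟨ count-≡-Σ-fiber xs P φ ⟨
    count P xs                                  ∎
    where
    open ≤-Reasoning
    bound : ∀ y → e * indicator (image φ P xs y) ≤ fiber φ P xs y
    bound y with image φ P xs y in im
    ... | false = ≤-trans (≤-reflexive (*-zeroʳ e)) z≤n
    ... | true with any-true⁻ _ xs im
    ...   | x , _ , x∈ with inFiber⁻ φ P x∈
    ...     | Px , refl = ≤-trans (≤-reflexive (*-identityʳ e)) (fibers-large x Px)

  count-image-≡-of-injective : (xs : List X) → Unique xs → (P : X → Bool) (φ : X → Y) →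
    (∀ a b → P a ≡ true → P b ≡ true → φ a ≡ φ b → a ≡ b) →
    count (image φ P xs) ys ≡ count P xs
  count-image-≡-of-injective xs xs-unique P φ φ-injective =
    sym (trans (count-≡-Σ-fiber xs P φ) (Σ-over-cong ys (λ y _ → fiber-≡-indicator y)))
    where
    fiber-≡-indicator : ∀ y → fiber φ P xs y ≡ indicator (image φ P xs y)
    fiber-≡-indicator y with image φ P xs y in im
    ... | true = let x , x∈xs , x∈ = any-true⁻ _ xs im in
      ≤-antisym (fiber-≤1 xs-unique φ-injective y) (count-≥1 _ x∈xs x∈)
    ... | false = count-≡0 _ xs outside
      where
      outside : ∀ x → x ∈ xs → inFiber φ P y x ≡ false
      outside x x∈xs with inFiber φ P y x in x∈
      ... | false = refl
      ... | true with () ← trans (sym (any-true⁺ _ x∈xs x∈)) im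

allVecs-complete : (xs : List X) → (∀ x → x ∈ xs) → ∀ k (v : Vec X k) → v ∈ allVecs xs k
allVecs-complete xs xs-complete zero [] = here refl
allVecs-complete xs xs-complete (suc k) (a ∷ v) = go xs (xs-complete a)
  where
  go : ∀ ys → a ∈ ys → (a ∷ v) ∈ concatMap (λ x → L.map (x ∷_) (allVecs xs k)) ys
  go (y ∷ ys) (here refl) = ∈-++⁺ˡ (∈-map⁺ (a ∷_) (allVecs-complete xs xs-complete k v))
  go (y ∷ ys) (there a∈) = ∈-++⁺ʳ (L.map (y ∷_) (allVecs xs k)) (go ys a∈)

allVecs-unique : (xs : List X) → Unique xs → ∀ k → Unique (allVecs xs k)
allVecs-unique xs xs-unique zero = ListAll.[] ∷ []
allVecs-unique {X} xs xs-unique (suc k) = go xs xs-unique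
  where
  consAll : List X → List (Vec X (suc k))
  consAll = concatMap (λ x → L.map (x ∷_) (allVecs xs k))
  head∈ : ∀ ys {w : Vec X (suc k)} → w ∈ consAll ys → V.head w ∈ ys
  head∈ (y ∷ ys) w∈ with ∈-++⁻ (L.map (y ∷_) (allVecs xs k)) w∈
  ... | inj₁ w∈y∷ with _ , _ , refl ← ∈-map⁻ (y ∷_) w∈y∷ = here refl
  ... | inj₂ w∈ys = there (head∈ ys w∈ys)
  go : ∀ ys → Unique ys → Unique (consAll ys)
  go [] _ = []
  go (y ∷ ys) (y∉ys ∷ ys-unique) =
    ++⁺ (map⁺ (λ e → proj₂ (∷-injective e)) (allVecs-unique xs xs-unique k)) (go ys ys-unique) disjoint
    where
    disjoint : ∀ {v} → ¬ (v ∈ L.map (y ∷_) (allVecs xs k) × v ∈ consAll ys)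
    disjoint (v∈y∷ , v∈ys) with _ , _ , refl ← ∈-map⁻ (y ∷_) v∈y∷ =
      ListAll.lookup y∉ys (head∈ ys v∈ys) refl

module LinearMaps (F : FiniteField) (n : ℕ) where
  open FiniteField F using (Carrier; 0#; 1#; -_; isCommutativeRing) renaming (_+_ to _+ꜰ_; _*_ to _*ꜰ_)
  open Over F n
  private module R = IsCommutativeRing isCommutativeRing

  +ᵥ-isCommutativeMonoid : IsCommutativeMonoid _≡_ _+ᵥ_ 0ᵥ
  +ᵥ-isCommutativeMonoid = record
    { isMonoid = record
      { isSemigroup = record
        { isMagma = record { isEquivalence = isEquivalence ; ∙-cong = cong₂ _+ᵥ_ }
        ; assoc = zipWith-assoc R.+-assoc }
      ; identity = zipWith-identityˡ R.+-identityˡ , zipWith-identityʳ R.+-identityʳ }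
    ; comm = zipWith-comm R.+-comm }

  open IsCommutativeMonoid +ᵥ-isCommutativeMonoid
    using ()
    renaming (assoc to +ᵥ-assoc; comm to +ᵥ-comm; identityˡ to +ᵥ-identityˡ; identityʳ to +ᵥ-identityʳ)

  +ᵥ-commutativeMonoid : CommutativeMonoid _ _
  +ᵥ-commutativeMonoid = record { isCommutativeMonoid = +ᵥ-isCommutativeMonoid }

  open CommutativeSemigroupProperties (CommutativeMonoid.commutativeSemigroup +ᵥ-commutativeMonoid)
    using () renaming (interchange to +ᵥ-interchange)

  •-identityˡ : (u : Vsp) → 1# • u ≡ u
  •-identityˡ u = trans (map-cong R.*-identityˡ u) (map-id u)

  •-zeroˡ : (u : Vsp) → 0# • u ≡ 0ᵥ
  •-zeroˡ u = trans (map-cong R.zeroˡ u) (map-const u 0#)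

  -1•-inverseˡ : (u : Vsp) → (- 1#) • u +ᵥ u ≡ 0ᵥ
  -1•-inverseˡ = zipWith-inverseˡ -1*-inverseˡ
    where
    -1*-inverseˡ : ∀ a → (- 1#) *ꜰ a +ꜰ a ≡ 0#
    -1*-inverseˡ a = begin
      (- 1#) *ꜰ a +ꜰ a        ≡⟨ cong ((- 1#) *ꜰ a +ꜰ_) (R.*-identityˡ a) ⟨
      (- 1#) *ꜰ a +ꜰ 1# *ꜰ a  ≡⟨ R.distribʳ a (- 1#) 1# ⟨
      ((- 1#) +ꜰ 1#) *ꜰ a     ≡⟨ cong (_*ꜰ a) (R.-‿inverseˡ 1#) ⟩
      0# *ꜰ a                 ≡⟨ R.zeroˡ a ⟩
      0#                      ∎
      where open ≡-Reasoning

  +ᵥ-cancelʳ : (u v w : Vsp) → u +ᵥ w ≡ v +ᵥ w → u ≡ v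
  +ᵥ-cancelʳ u v w eq = trans (sym (cancel u)) (trans (cong (_+ᵥ (- 1#) • w) eq) (cancel v))
    where
    open ≡-Reasoning
    cancel : ∀ t → t +ᵥ w +ᵥ (- 1#) • w ≡ t
    cancel t = begin
      t +ᵥ w +ᵥ (- 1#) • w    ≡⟨ +ᵥ-assoc t w _ ⟩
      t +ᵥ (w +ᵥ (- 1#) • w)  ≡⟨ cong (t +ᵥ_) (trans (+ᵥ-comm w _) (-1•-inverseˡ w)) ⟩
      t +ᵥ 0ᵥ                 ≡⟨ +ᵥ-identityʳ t ⟩
      t                       ∎

  linComb : {k : ℕ} → (Fin k → Carrier) → Tuple k → Vsp
  linComb a x = σ _ (tabulate (λ i → a i • lookup x i))

  linComb-cong : {k : ℕ} {a b : Fin k → Carrier} (x : Tuple k) → (∀ i → a i ≡ b i) →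
    linComb a x ≡ linComb b x
  linComb-cong x a≗b = cong (σ _) (tabulate-cong (λ i → cong (_• lookup x i) (a≗b i)))

  linComb-zero : {k : ℕ} (x : Tuple k) → linComb (λ _ → 0#) x ≡ 0ᵥ
  linComb-zero [] = refl
  linComb-zero (u ∷ x) rewrite linComb-zero x | •-zeroˡ u = +ᵥ-identityˡ 0ᵥ

  linComb-one : {k : ℕ} (x : Tuple k) → linComb (λ _ → 1#) x ≡ σ k x
  linComb-one [] = refl
  linComb-one (u ∷ x) = cong₂ _+ᵥ_ (•-identityˡ u) (linComb-one x)

  δ : {k : ℕ} → Fin k → Fin k → Carrier
  δ zero zero = 1#
  δ zero (suc _) = 0#
  δ (suc _) zero = 0#
  δ (suc i) (suc t) = δ i t

  linComb-δ : {k : ℕ} (x : Tuple k) (t : Fin k) → linComb (λ i → δ i t) x ≡ lookup x t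
  linComb-δ (u ∷ x) zero rewrite linComb-zero x | •-identityˡ u = +ᵥ-identityʳ u
  linComb-δ (u ∷ x) (suc t) rewrite linComb-δ x t | •-zeroˡ u = +ᵥ-identityˡ (lookup x t)

  matrix : {k k' : ℕ} → (Fin k → Fin k' → Carrier) → LinMap k k'
  matrix f = tabulate (λ i → tabulate (f i))

  apply-matrix : {k k' : ℕ} (f : Fin k → Fin k' → Carrier) (x : Tuple k) →
    apply (matrix f) x ≡ tabulate (λ j → linComb (λ i → f i j) x)
  apply-matrix f x = tabulate-cong λ j → linComb-cong x λ i →
    trans (cong (λ row → lookup row j) (lookup∘tabulate (λ i → tabulate (f i)) i)) (lookup∘tabulate (f i) j)

  select : {k k' : ℕ} → (Fin k' → Fin k) → LinMap k k'
  select s = matrix (λ i j → δ i (s j))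

  apply-select : {k k' : ℕ} (s : Fin k' → Fin k) (x : Tuple k) →
    apply (select s) x ≡ tabulate (λ j → lookup x (s j))
  apply-select s x = trans (apply-matrix _ x) (tabulate-cong (λ j → linComb-δ x (s j)))

  identityMap : {k : ℕ} → LinMap k k
  identityMap = select (λ i → i)

  apply-identityMap : {k : ℕ} (x : Tuple k) → apply identityMap x ≡ x
  apply-identityMap x = trans (apply-select _ x) (tabulate∘lookup x)

  dropHead : {k : ℕ} → LinMap (suc k) k
  dropHead = select suc

  apply-dropHead : {k : ℕ} (u : Vsp) (x : Tuple k) → apply dropHead (u ∷ x) ≡ x
  apply-dropHead u x = trans (apply-select suc (u ∷ x)) (tabulate∘lookup x)

  skipSecond : {k : ℕ} → Fin (suc k) → Fin (suc (suc k))
  skipSecond zero = zero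
  skipSecond (suc j) = suc (suc j)

  dropSecond : {k : ℕ} → LinMap (suc (suc k)) (suc k)
  dropSecond = select skipSecond

  apply-dropSecond : {k : ℕ} (u v : Vsp) (x : Tuple k) → apply dropSecond (u ∷ v ∷ x) ≡ u ∷ x
  apply-dropSecond u v x = trans (apply-select skipSecond (u ∷ v ∷ x)) (cong (u ∷_) (tabulate∘lookup x))

  swap01 : {k : ℕ} → Fin (suc (suc k)) → Fin (suc (suc k))
  swap01 zero = suc zero
  swap01 (suc zero) = zero
  swap01 (suc (suc j)) = suc (suc j)

  swapHeads : {k : ℕ} → LinMap (suc (suc k)) (suc (suc k))
  swapHeads = select swap01

  apply-swapHeads : {k : ℕ} (u v : Vsp) (x : Tuple k) → apply swapHeads (u ∷ v ∷ x) ≡ v ∷ u ∷ x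
  apply-swapHeads u v x =
    trans (apply-select swap01 (u ∷ v ∷ x)) (cong (λ y → v ∷ u ∷ y) (tabulate∘lookup x))

  dropFirst : (k' k : ℕ) → LinMap (k' + k) k
  dropFirst k' k = select (k' ↑ʳ_)

  apply-dropFirst : {k' k : ℕ} (w : Tuple k') (x : Tuple k) → apply (dropFirst k' k) (w ++ x) ≡ x
  apply-dropFirst {k'} w x =
    trans (apply-select (k' ↑ʳ_) (w ++ x)) (trans (tabulate-cong (lookup-++ʳ w x)) (tabulate∘lookup x))

  consIndex : (k' k : ℕ) → Fin (k' + k) → Fin (suc k) → Fin (k' + k)
  consIndex k' k l zero = l
  consIndex k' k l (suc j) = k' ↑ʳ j

  consCoordinate : (k' k : ℕ) → Fin (k' + k) → LinMap (k' + k) (suc k)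
  consCoordinate k' k l = select (consIndex k' k l)

  apply-consCoordinate : {k' k : ℕ} (l : Fin (k' + k)) (c : Tuple (k' + k)) →
    apply (consCoordinate k' k l) c ≡ lookup c l ∷ apply (dropFirst k' k) c
  apply-consCoordinate {k'} {k} l c =
    trans (apply-select (consIndex k' k l) c) (cong (lookup c l ∷_) (sym (apply-select (k' ↑ʳ_) c)))

  signs : (k' k : ℕ) → Fin (k' + k) → Carrier
  signs zero k i = 1#
  signs (suc k') k zero = - 1#
  signs (suc k') k (suc i) = signs k' k i

  linComb-signs : {k' k : ℕ} (w : Tuple k') (x : Tuple k) → linComb (signs k' k) (w ++ x) +ᵥ σ k' w ≡ σ k x
  linComb-signs [] x = trans (+ᵥ-identityʳ _) (linComb-one x)
  linComb-signs {suc k'} {k} (u ∷ w) x = begin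
    ((- 1#) • u +ᵥ linComb (signs k' k) (w ++ x)) +ᵥ (u +ᵥ σ k' w)
      ≡⟨ +ᵥ-interchange _ _ _ _ ⟩
    ((- 1#) • u +ᵥ u) +ᵥ (linComb (signs k' k) (w ++ x) +ᵥ σ k' w)
      ≡⟨ cong₂ _+ᵥ_ (-1•-inverseˡ u) (linComb-signs w x) ⟩
    0ᵥ +ᵥ σ k x
      ≡⟨ +ᵥ-identityˡ _ ⟩
    σ k x
      ∎
    where open ≡-Reasoning

  σ-completionCoefficient : (k' k : ℕ) → Fin (k' + k) → Fin (suc k') → Carrier
  σ-completionCoefficient k' k i zero = signs k' k i
  σ-completionCoefficient k' k i (suc j) = δ i (j ↑ˡ k)

  -- (w , x) ↦ (σ x − σ w) ∷ w
  σ-completion : (k' k : ℕ) → LinMap (k' + k) (suc k')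
  σ-completion k' k = matrix (σ-completionCoefficient k' k)

  apply-σ-completion : {k' k : ℕ} (w : Tuple k') (x : Tuple k) →
    apply (σ-completion k' k) (w ++ x) ≡ linComb (signs k' k) (w ++ x) ∷ w
  apply-σ-completion {k'} {k} w x =
    trans (apply-matrix (σ-completionCoefficient k' k) (w ++ x)) (cong (linComb (signs k' k) (w ++ x) ∷_)
      (trans (tabulate-cong (λ j → trans (linComb-δ (w ++ x) (j ↑ˡ k)) (lookup-++ˡ w x j)))
             (tabulate∘lookup w)))

  σ-apply-σ-completion : (k' k : ℕ) (c : Tuple (k' + k)) →
    σ (suc k') (apply (σ-completion k' k) c) ≡ σ k (apply (dropFirst k' k) c)
  σ-apply-σ-completion k' k c with w , x , refl ← V.splitAt k' c = begin
    σ (suc k') (apply (σ-completion k' k) (w ++ x))  ≡⟨ cong (σ (suc k')) (apply-σ-completion w x) ⟩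
    linComb (signs k' k) (w ++ x) +ᵥ σ k' w           ≡⟨ linComb-signs w x ⟩
    σ k x                                            ≡⟨ cong (σ k) (apply-dropFirst w x) ⟨
    σ k (apply (dropFirst k' k) (w ++ x))            ∎
    where open ≡-Reasoning

  apply-σ-completion-of-σ≡ : {k' k : ℕ} (u : Vsp) (w : Tuple k') (x : Tuple k) →
    σ (suc k') (u ∷ w) ≡ σ k x → apply (σ-completion k' k) (w ++ x) ≡ u ∷ w
  apply-σ-completion-of-σ≡ u w x σ≡ = trans (apply-σ-completion w x) (cong (_∷ w)
    (+ᵥ-cancelʳ _ u _ (trans (linComb-signs w x) (sym σ≡))))

  σ-completion-dropFirst-injective : (k' k : ℕ) (c c' : Tuple (k' + k)) →
    apply (σ-completion k' k) c ≡ apply (σ-completion k' k) c' →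
    apply (dropFirst k' k) c ≡ apply (dropFirst k' k) c' → c ≡ c'
  σ-completion-dropFirst-injective k' k c c' eq₁ eq₂
    with w , x , refl ← V.splitAt k' c | w' , x' , refl ← V.splitAt k' c'
    rewrite apply-σ-completion w x | apply-σ-completion w' x' | apply-dropFirst w x | apply-dropFirst w' x'
    with refl ← eq₂ | _ , refl ← ∷-injective eq₁ = refl

module LinearScheme (F : FiniteField) (n m : ℕ) (S : Over.Vsp F n → Bool) (Π : Over.Scheme F n)
  (isLinear : Over.IsLinearScheme F n m S Π) (antisymmetric : Over.StronglyAntisymmetric F n m Π) where
  open FiniteField F using (elems; complete; unique)
  open Over F n
  open LinearMaps F n
  open IsLinearScheme isLinear

  allV-unique : Unique allV
  allV-unique = allVecs-unique elems unique n

  allV-complete : ∀ v → v ∈ allV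
  allV-complete = allVecs-complete elems complete n

  allT-unique : ∀ k → Unique (allT k)
  allT-unique = allVecs-unique allV allV-unique

  allT-complete : ∀ k x → x ∈ allT k
  allT-complete = allVecs-complete allV allV-complete

  module Tuples (k : ℕ) = Enumerated (_≟ₜ_ {k}) (allT k) (allT-unique k) (allT-complete k)
  module Vectors = Enumerated _≟ᵥ_ allV allV-unique allV-complete

  block-⊆-S : ∀ {k} → InRange m k → ∀ {B} → B ∈ Π k → ∀ {t} → B t ≡ true →
    All (λ v → S v ≡ true) t
  block-⊆-S rk {B} B∈ {t} = block-⊆ _ rk B B∈ t

  mapsOnto-of-hit : ∀ {k k'} → InRange m k → InRange m k' → ∀ {B B'} → B ∈ Π k → B' ∈ Π k' →
    (c : LinMap k k') {x : Tuple k} → B x ≡ true → B' (apply c x) ≡ true → MapsOnto c B B'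
  mapsOnto-of-hit rk rk' {B} {B'} B∈ B'∈ c {x} Bx B'cx with P1 _ _ rk rk' B B' B∈ B'∈ c
  ... | inj₁ onto = onto
  ... | inj₂ misses with () ← trans (sym B'cx) (misses x Bx)

  fiber-≥1 : ∀ {k k'} {B : Subset k} (c : LinMap k k') {x y} → B x ≡ true → apply c x ≡ y →
    1 ≤ fiber c B y
  fiber-≥1 {k} {k'} {B} c {x} Bx cx≡y =
    count-≥1 _ (allT-complete k x) (Tuples.inFiber⁺ k' (apply c) B Bx cx≡y)

  fiber-≥2 : ∀ {k k'} {B : Subset k} (c : LinMap k k') {x x' y} → x ≢ x' →
    B x ≡ true → B x' ≡ true → apply c x ≡ y → apply c x' ≡ y → 2 ≤ fiber c B y
  fiber-≥2 {k} {k'} {B} c x≢x' Bx Bx' cx≡y cx'≡y = count-≥2 _ x≢x' (allT-complete k _) (allT-complete k _)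
    (Tuples.inFiber⁺ k' (apply c) B Bx cx≡y) (Tuples.inFiber⁺ k' (apply c) B Bx' cx'≡y)

  fiber-≥2⇒∃₂ : ∀ {k k'} {B : Subset k} (c : LinMap k k') {y} → 2 ≤ fiber c B y →
    ∃₂ λ x x' → x ≢ x' × (B x ≡ true × apply c x ≡ y) × (B x' ≡ true × apply c x' ≡ y)
  fiber-≥2⇒∃₂ {k} {k'} {B} c 2≤
    with x , x' , x≢x' , x∈ , x'∈ ← count-≥2⇒∃₂ _ (allT-unique k) 2≤ =
    x , x' , x≢x' , Tuples.inFiber⁻ k' (apply c) B x∈ , Tuples.inFiber⁻ k' (apply c) B x'∈

  injective-of-fibers-≤1 : ∀ {k k'} {B : Subset k} {B' : Subset k'} (c : LinMap k k') → MapsOnto c B B' →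
    (∀ y → B' y ≡ true → fiber c B y ≤ 1) → InjOn B (apply c)
  injective-of-fibers-≤1 c (into , _) fibers≤1 x x' Bx Bx' cx≡cx' with x ≟ₜ x'
  ... | yes x≡x' = x≡x'
  ... | no x≢x' = ⊥-elim (≤⇒≯ (fibers≤1 _ (into x Bx)) (fiber-≥2 c x≢x' Bx Bx' refl (sym cx≡cx')))

  fibers-≡1-transfer : ∀ {k k'} → InRange m k → InRange m k' →
    ∀ {B B'} → B ∈ Π k → B' ∈ Π k' →
    (c₁ c₂ : LinMap k k') → MapsOnto c₁ B B' → (∀ x → B x ≡ true → B' (apply c₂ x) ≡ true) →
    (∀ y → B' y ≡ true → fiber c₁ B y ≡ 1) → ∀ y → B' y ≡ true → fiber c₂ B y ≡ 1
  fibers-≡1-transfer {k} {k'} rk rk' {B} {B'} B∈ B'∈ c₁ c₂ (into₁ , _) into₂ fibers₁ y B'y =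
    sym (*-cancelʳ-≡ 1 _ (card k' B') {{>-nonZero (count-≥1 B' (allT-complete k' y) B'y)}} card-eq)
    where
    card-eq : 1 * card k' B' ≡ fiber c₂ B y * card k' B'
    card-eq = trans (sym (Tuples.count-≡-*-of-fibers-≡ k' (allT k) B B' (apply c₁) 1 into₁ fibers₁))
      (Tuples.count-≡-*-of-fibers-≡ k' (allT k) B B' (apply c₂) _ into₂
        (λ y' B'y' → P2 k k' rk rk' B B' B∈ B'∈ c₂ y' y B'y' B'y))

  -- Strong antisymmetry is used here: if c₁ is bijective on B, so is c₂ (by counting), and
  -- c₂ ∘ c₁⁻¹ is then a permutation of the block B' composed of bijections between blocks.
  images-agree : ∀ {k k'} → InRange m k → InRange m k' → ∀ {B B'} → B ∈ Π k → B' ∈ Π k' →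
    (c₁ c₂ : LinMap k k') {z : Tuple k} {y₁ y₂ : Tuple k'} → B z ≡ true →
    apply c₁ z ≡ y₁ → apply c₂ z ≡ y₂ → B' y₁ ≡ true → B' y₂ ≡ true →
    fiber c₁ B y₁ ≤ 1 → y₁ ≡ y₂
  images-agree {k} {k'} rk rk' {B} {B'} B∈ B'∈ c₁ c₂ {z} Bz refl refl B'y₁ B'y₂ fiber≤1 =
    antisymmetric k' rk' B' B'∈ _ _ B'y₁ B'y₂
      (fwd (bwd here rk rk' B B' B∈ B'∈ c₁ (bijective c₁ onto₁ fibers₁) z Bz refl)
           rk rk' B B' B∈ B'∈ c₂ (bijective c₂ onto₂ fibers₂) Bz)
    where
    onto₁ : MapsOnto c₁ B B'
    onto₁ = mapsOnto-of-hit rk rk' B∈ B'∈ c₁ Bz B'y₁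
    onto₂ : MapsOnto c₂ B B'
    onto₂ = mapsOnto-of-hit rk rk' B∈ B'∈ c₂ Bz B'y₂
    fibers₁ : ∀ y → B' y ≡ true → fiber c₁ B y ≡ 1
    fibers₁ y B'y =
      trans (P2 k k' rk rk' B B' B∈ B'∈ c₁ y _ B'y B'y₁) (≤-antisym fiber≤1 (fiber-≥1 c₁ Bz refl))
    fibers₂ : ∀ y → B' y ≡ true → fiber c₂ B y ≡ 1
    fibers₂ = fibers-≡1-transfer rk rk' B∈ B'∈ c₁ c₂ onto₁ (proj₁ onto₂) fibers₁
    bijective : (c : LinMap k k') → MapsOnto c B B' → (∀ y → B' y ≡ true → fiber c B y ≡ 1) →
      BijStep c B B'
    bijective c onto fibers = onto , injective-of-fibers-≤1 c onto (λ y B'y → ≤-reflexive (fibers y B'y))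

  inRange-of-≡ : ∀ r {k} → m ≡ r + suc k → InRange m (suc k)
  inRange-of-≡ r {k} m≡ = s≤s z≤n , ≤-trans (m≤n+m (suc k) r) (≤-reflexive (sym m≡))

  ∷-≢ : ∀ {k} {u u' : Vsp} (x : Tuple k) → u ≢ u' → u ∷ x ≢ u' ∷ x
  ∷-≢ x u≢u' eq = u≢u' (proj₁ (∷-injective eq))

  head-swap-in-block⇒≡ : ∀ {k} → InRange m (suc (suc k)) → ∀ {E} → E ∈ Π (suc (suc k)) →
    ∀ {u v x} → E (u ∷ v ∷ x) ≡ true → E (v ∷ u ∷ x) ≡ true → u ≡ v
  head-swap-in-block⇒≡ {k} rk {E} E∈ {u} {v} {x} Euvx Evux = proj₁ (∷-injective
    (images-agree rk rk E∈ E∈ identityMap swapHeads Euvx (apply-identityMap _) (apply-swapHeads u v x) Euvx Evux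
      (Tuples.fiber-≤1 (suc (suc k)) {P = E} (allT-unique _) identity-injective (u ∷ v ∷ x))))
    where
    identity-injective : ∀ a b → _ → _ → apply identityMap a ≡ apply identityMap b → a ≡ b
    identity-injective a b _ _ eq = trans (sym (apply-identityMap a)) (trans eq (apply-identityMap b))

  head-swapped-blocks-disjoint : ∀ {k} → InRange m (suc (suc k)) → ∀ {B B'} → B ∈ Π (suc (suc k)) →
    B' ∈ Π (suc (suc k)) → ∀ {u v x} → u ≢ v →
    B (u ∷ v ∷ x) ≡ true → B' (v ∷ u ∷ x) ≡ true →
    ∀ t → B t ≡ true → B' t ≡ true → ⊥
  head-swapped-blocks-disjoint rk {B} {B'} B∈ B'∈ {u} {v} {x} u≢v Buvx B'vux t Bt B't =
    u≢v (head-swap-in-block⇒≡ rk B∈ Buvx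
      (trans (disjoint _ rk B B' B∈ B'∈ t Bt B't (v ∷ u ∷ x)) B'vux))

  apply-dropHead⁻¹ : ∀ {k} (u : Vsp) (x : Tuple k) {y : Tuple k} → apply dropHead (u ∷ x) ≡ y → x ≡ y
  apply-dropHead⁻¹ u x = trans (sym (apply-dropHead u x))

  apply-dropSecond-injective : ∀ {k} (a a' u : Vsp) (x : Tuple k) →
    apply dropSecond (a ∷ u ∷ x) ≡ apply dropSecond (a' ∷ u ∷ x) → a ≡ a'
  apply-dropSecond-injective a a' u x eq =
    proj₁ (∷-injective (trans (sym (apply-dropSecond a u x)) (trans eq (apply-dropSecond a' u x))))

  DropHeadFiberGrowth : ℕ → ℕ → Set
  DropHeadFiberGrowth r k = ∀ {D} → D ∈ Π (suc k) → ∀ {u u' x} → u ≢ u' →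
    D (u ∷ x) ≡ true → D (u' ∷ x) ≡ true → 2 ^ suc r ≤ fiber dropHead D x

  dropHead-fiber-growth-base : ∀ {k} → DropHeadFiberGrowth 0 k
  dropHead-fiber-growth-base D∈ {u} {u'} {x} u≢u' Dux Du'x =
    fiber-≥2 dropHead (∷-≢ x u≢u') Dux Du'x (apply-dropHead u x) (apply-dropHead u' x)

  -- Either the fiber of E over b ∷ x contains two tuples a₁ ∷ b ∷ x, a₂ ∷ b ∷ x and we may recurse,
  -- or dropHead and dropSecond would identify b ∷ x with a ∷ x.
  dropHead-fiber-of-block : ∀ r {k} → m ≡ suc r + suc k → DropHeadFiberGrowth r (suc k) →
    ∀ {D E} → D ∈ Π (suc k) → E ∈ Π (suc (suc k)) → ∀ {a b x} → a ≢ b →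
    E (a ∷ b ∷ x) ≡ true → D (a ∷ x) ≡ true → D (b ∷ x) ≡ true →
    2 ^ suc r ≤ fiber dropHead E (b ∷ x)
  dropHead-fiber-of-block r {k} m≡ growth {E = E} D∈ E∈ {a} {b} {x} a≢b Eabx Dax Dbx
    with 2 ≤? fiber dropHead E (b ∷ x)
  ... | no 2≰ = ⊥-elim (a≢b (sym (proj₁ (∷-injective
    (images-agree (inRange-of-≡ r (trans m≡ (sym (+-suc r (suc k))))) (inRange-of-≡ (suc r) m≡) E∈ D∈
      dropHead dropSecond Eabx (apply-dropHead a (b ∷ x)) (apply-dropSecond a b x) Dbx Dax
      (s≤s⁻¹ (≰⇒> 2≰)))))))
  ... | yes 2≤ with fiber-≥2⇒∃₂ {B = E} dropHead 2≤
  ...   | a₁ ∷ s₁ , a₂ ∷ s₂ , t₁≢t₂ , (Et₁ , t₁↦) , (Et₂ , t₂↦)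
        with refl ← apply-dropHead⁻¹ a₁ s₁ t₁↦ | refl ← apply-dropHead⁻¹ a₂ s₂ t₂↦ =
    growth E∈ (λ a₁≡a₂ → t₁≢t₂ (cong (_∷ b ∷ x) a₁≡a₂)) Et₁ Et₂

  dropHead-fibers-+-≤ : ∀ {k} {E E' : Subset (suc (suc k))} {D : Subset (suc k)} {u : Vsp} {x : Tuple k} →
    (∀ t → E t ≡ true → D (apply dropSecond t) ≡ true) →
    (∀ t → E' t ≡ true → D (apply dropSecond t) ≡ true) →
    (∀ t → E t ≡ true → E' t ≡ true → ⊥) →
    fiber dropHead E (u ∷ x) + fiber dropHead E' (u ∷ x) ≤ fiber dropHead D x
  dropHead-fibers-+-≤ {k} {E} {E'} {D} {u} {x} E⇒D E'⇒D E∩E'=∅ = begin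
    fiber dropHead E (u ∷ x) + fiber dropHead E' (u ∷ x)
      ≡⟨ count-∨ inE inE' (allT _) (λ t t∈E t∈E' →
           E∩E'=∅ t (proj₁ (fiber⁻ E t∈E)) (proj₁ (fiber⁻ E' t∈E'))) ⟩
    count (λ t → inE t ∨ inE' t) (allT _)
      ≤⟨ Tuples.count-≤-of-injective (suc k) (allT _) (allT-unique _) _ _ (apply dropSecond) into injective ⟩
    fiber dropHead D x
      ∎
    where
    open ≤-Reasoning
    inE inE' : Subset (suc (suc k))
    inE = Tuples.inFiber (suc k) (apply dropHead) E (u ∷ x)
    inE' = Tuples.inFiber (suc k) (apply dropHead) E' (u ∷ x)
    fiber⁻ : (B : Subset (suc (suc k))) {t : Tuple (suc (suc k))} →
      Tuples.inFiber (suc k) (apply dropHead) B (u ∷ x) t ≡ true → B t ≡ true × apply dropHead t ≡ u ∷ x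
    fiber⁻ B = Tuples.inFiber⁻ (suc k) (apply dropHead) B
    member : ∀ t → (inE t ∨ inE' t) ≡ true → D (apply dropSecond t) ≡ true × apply dropHead t ≡ u ∷ x
    member t t∈ with inE t in t∈E
    ... | true = let Et , t↦ = fiber⁻ E t∈E in E⇒D t Et , t↦
    ... | false = let E't , t↦ = fiber⁻ E' t∈ in E'⇒D t E't , t↦
    into : ∀ t → (inE t ∨ inE' t) ≡ true →
      Tuples.inFiber k (apply dropHead) D x (apply dropSecond t) ≡ true
    into (a ∷ s) t∈ with member (a ∷ s) t∈
    ... | Dt , t↦ with refl ← apply-dropHead⁻¹ a s t↦ =
      Tuples.inFiber⁺ k (apply dropHead) D Dt
        (trans (cong (apply dropHead) (apply-dropSecond a u x)) (apply-dropHead a x))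
    injective : ∀ t t' → (inE t ∨ inE' t) ≡ true → (inE t' ∨ inE' t') ≡ true →
      apply dropSecond t ≡ apply dropSecond t' → t ≡ t'
    injective (a ∷ s) (a' ∷ s') t∈ t'∈ eq with member (a ∷ s) t∈ | member (a' ∷ s') t'∈
    ... | _ , t↦ | _ , t'↦ with refl ← apply-dropHead⁻¹ a s t↦ | refl ← apply-dropHead⁻¹ a' s' t'↦ =
      cong (_∷ u ∷ x) (apply-dropSecond-injective a a' u x eq)

  dropHead-fiber-growth-step : ∀ r {k} → m ≡ suc r + suc k → DropHeadFiberGrowth r (suc k) →
    DropHeadFiberGrowth (suc r) k
  dropHead-fiber-growth-step r {k} m≡ growth {D} D∈ {u} {u'} {x} u≢u' Dux Du'x =
    bound (cover _ rk₂ (u' ∷ u ∷ x) (S-head Du'x ∷ block-⊆-S rk₁ D∈ Dux))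
          (cover _ rk₂ (u ∷ u' ∷ x) (S-head Dux ∷ block-⊆-S rk₁ D∈ Du'x))
    where
    open ≤-Reasoning
    rk₁ : InRange m (suc k)
    rk₁ = inRange-of-≡ (suc r) m≡
    rk₂ : InRange m (suc (suc k))
    rk₂ = inRange-of-≡ r (trans m≡ (sym (+-suc r (suc k))))
    S-head : ∀ {a} → D (a ∷ x) ≡ true → S a ≡ true
    S-head Dax = All.head (block-⊆-S rk₁ D∈ Dax)
    dropSecond-into : ∀ {B} → B ∈ Π (suc (suc k)) → ∀ {a b} → B (a ∷ b ∷ x) ≡ true →
      D (a ∷ x) ≡ true → ∀ t → B t ≡ true → D (apply dropSecond t) ≡ true
    dropSecond-into B∈ {a} {b} Babx Dax = proj₁ (mapsOnto-of-hit rk₂ rk₁ B∈ D∈ dropSecond Babx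
      (subst (λ y → D y ≡ true) (sym (apply-dropSecond a b x)) Dax))
    bound : (∃ λ E → E ∈ Π (suc (suc k)) × E (u' ∷ u ∷ x) ≡ true) →
            (∃ λ E' → E' ∈ Π (suc (suc k)) × E' (u ∷ u' ∷ x) ≡ true) →
            2 ^ suc (suc r) ≤ fiber dropHead D x
    bound (E , E∈ , Eu'ux) (E' , E'∈ , E'uu'x) = begin
      2 ^ suc (suc r)
        ≡⟨ cong (2 ^ suc r +_) (+-identityʳ (2 ^ suc r)) ⟩
      2 ^ suc r + 2 ^ suc r
        ≤⟨ +-mono-≤ (dropHead-fiber-of-block r m≡ growth D∈ E∈ (≢-sym u≢u') Eu'ux Du'x Dux)
                    (≤-trans (dropHead-fiber-of-block r m≡ growth D∈ E'∈ u≢u' E'uu'x Dux Du'x)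
                             (≤-reflexive (P2 _ _ rk₂ rk₁ E' D E'∈ D∈ dropHead _ _ Du'x Dux))) ⟩
      fiber dropHead E (u ∷ x) + fiber dropHead E' (u ∷ x)
        ≤⟨ dropHead-fibers-+-≤ (dropSecond-into E∈ Eu'ux Du'x) (dropSecond-into E'∈ E'uu'x Dux)
             (head-swapped-blocks-disjoint rk₂ E∈ E'∈ (≢-sym u≢u') Eu'ux E'uu'x) ⟩
      fiber dropHead D x
        ∎

  dropHead-fiber-growth : ∀ r {k} → m ≡ r + suc k → DropHeadFiberGrowth r k
  dropHead-fiber-growth zero m≡ = dropHead-fiber-growth-base
  dropHead-fiber-growth (suc r) {k} m≡ =
    dropHead-fiber-growth-step r m≡ (dropHead-fiber-growth r (trans m≡ (sym (+-suc r (suc k)))))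

  ∃-lookup-≢ : ∀ {k} (c c' : Tuple k) → c ≢ c' → ∃ λ l → lookup c l ≢ lookup c' l
  ∃-lookup-≢ [] [] c≢c' = ⊥-elim (c≢c' refl)
  ∃-lookup-≢ (u ∷ c) (u' ∷ c') c≢c' with u ≟ᵥ u'
  ... | no u≢u' = zero , u≢u'
  ... | yes refl with l , differ ← ∃-lookup-≢ c c' (λ c≡c' → c≢c' (cong (u ∷_) c≡c')) =
    suc l , differ

  preimage : ∀ {k k'} {B : Subset k} {B' : Subset k'} (c : LinMap k k') → MapsOnto c B B' → Tuple k' → Tuple k
  preimage {B' = B'} c (_ , onto) t with B' t ≟ᵇ true
  ... | yes B't = proj₁ (onto t B't)
  ... | no _ = V.replicate _ 0ᵥ

  preimage-spec : ∀ {k k'} {B : Subset k} {B' : Subset k'} (c : LinMap k k') (mo : MapsOnto c B B') →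
    ∀ t → B' t ≡ true → B (preimage c mo t) ≡ true × apply c (preimage c mo t) ≡ t
  preimage-spec {B' = B'} c (_ , onto) t B't with B' t ≟ᵇ true
  ... | yes B't' = proj₂ (onto t B't')
  ... | no B't≢ = ⊥-elim (B't≢ B't)

  fiber-≤-of-onto : ∀ {k k₁ k₂} {B : Subset k} {B₁ : Subset k₁}
    (c : LinMap k k₁) (d : LinMap k₁ k₂) (e : LinMap k k₂) →
    MapsOnto c B B₁ → (∀ s → apply d (apply c s) ≡ apply e s) → ∀ y → fiber d B₁ y ≤ fiber e B y
  fiber-≤-of-onto {k} {k₁} {k₂} {B} {B₁} c d e onto d∘c≗e y =
    Tuples.count-≤-of-injective k (allT k₁) (allT-unique k₁) _ _ (preimage c onto) into injective
    where
    inFiber-d : Subset k₁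
    inFiber-d = Tuples.inFiber k₂ (apply d) B₁ y
    preimage-spec′ : ∀ {t} → inFiber-d t ≡ true →
      B (preimage c onto t) ≡ true × apply c (preimage c onto t) ≡ t
    preimage-spec′ {t} t∈ = preimage-spec c onto t (proj₁ (Tuples.inFiber⁻ k₂ (apply d) B₁ t∈))
    into : ∀ t → inFiber-d t ≡ true → Tuples.inFiber k₂ (apply e) B y (preimage c onto t) ≡ true
    into t t∈ with Bs , cs≡t ← preimage-spec′ t∈ =
      Tuples.inFiber⁺ k₂ (apply e) B Bs
        (trans (sym (d∘c≗e (preimage c onto t)))
               (trans (cong (apply d) cs≡t) (proj₂ (Tuples.inFiber⁻ k₂ (apply d) B₁ t∈))))
    injective : ∀ t t' → inFiber-d t ≡ true → inFiber-d t' ≡ true →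
      preimage c onto t ≡ preimage c onto t' → t ≡ t'
    injective t t' t∈ t'∈ eq =
      trans (sym (proj₂ (preimage-spec′ t∈))) (trans (cong (apply c) eq) (proj₂ (preimage-spec′ t'∈)))

  σ-fiber : ∀ k → Subset k → Vsp → ℕ
  σ-fiber k A = Vectors.fiber (σ k) A (allT k)

  fiber-dropFirst-≤-σ-fiber : ∀ k' {k} {C : Subset (k' + k)} {A : Subset (suc k')} →
    (∀ c → C c ≡ true → A (apply (σ-completion k' k) c) ≡ true) →
    ∀ y → fiber (dropFirst k' k) C y ≤ σ-fiber (suc k') A (σ k y)
  fiber-dropFirst-≤-σ-fiber k' {k} {C} {A} C⇒A y =
    Tuples.count-≤-of-injective (suc k') (allT (k' + k)) (allT-unique _) _ _
      (apply (σ-completion k' k)) into injective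
    where
    into : ∀ c → Tuples.inFiber k (apply (dropFirst k' k)) C y c ≡ true →
      Vectors.inFiber (σ (suc k')) A (σ k y) (apply (σ-completion k' k) c) ≡ true
    into c c∈ with Cc , c↦y ← Tuples.inFiber⁻ k (apply (dropFirst k' k)) C c∈ =
      Vectors.inFiber⁺ (σ (suc k')) A (C⇒A c Cc) (trans (σ-apply-σ-completion k' k c) (cong (σ k) c↦y))
    injective : ∀ c c' → Tuples.inFiber k (apply (dropFirst k' k)) C y c ≡ true →
      Tuples.inFiber k (apply (dropFirst k' k)) C y c' ≡ true →
      apply (σ-completion k' k) c ≡ apply (σ-completion k' k) c' → c ≡ c'
    injective c c' c∈ c'∈ eq = σ-completion-dropFirst-injective k' k c c' eq
      (trans (proj₂ (Tuples.inFiber⁻ k (apply (dropFirst k' k)) C c∈))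
             (sym (proj₂ (Tuples.inFiber⁻ k (apply (dropFirst k' k)) C c'∈))))

  σ-fibers-large-of-collision : ∀ r {k'} → m ≡ r + suc (suc k') → InRange m (k' + suc k') →
    ∀ {C A} → C ∈ Π (k' + suc k') → A ∈ Π (suc k') →
    (∀ c → C c ≡ true → A (apply (σ-completion k' (suc k')) c) ≡ true) →
    ∀ {x} → A x ≡ true → 2 ≤ fiber (dropFirst k' (suc k')) C x →
    ∀ z → A z ≡ true → 2 ^ suc r ≤ σ-fiber (suc k') A (σ (suc k') z)
  σ-fibers-large-of-collision r {k'} m≡ rC {C} {A} C∈ A∈ C⇒A {x} Ax 2≤ z Az
    with fiber-≥2⇒∃₂ {B = C} (dropFirst k' (suc k')) 2≤
  ... | c₁ , c₂ , c₁≢c₂ , (Cc₁ , c₁↦x) , (Cc₂ , c₂↦x) with ∃-lookup-≢ c₁ c₂ c₁≢c₂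
  ... | l , differ =
    bound (cover (suc k) rk₁ (lookup c₁ l ∷ x)
      (lookup⁺ (block-⊆-S rC C∈ Cc₁) l ∷ block-⊆-S rk A∈ Ax))
    where
    k : ℕ
    k = suc k'
    p : LinMap (k' + k) k
    p = dropFirst k' k
    q : LinMap (k' + k) (suc k)
    q = consCoordinate k' k l
    rk₁ : InRange m (suc k)
    rk₁ = inRange-of-≡ r m≡
    rk : InRange m k
    rk = s≤s z≤n , ≤-trans (n≤1+n k) (proj₂ rk₁)
    apply-q : ∀ c → apply p c ≡ x → apply q c ≡ lookup c l ∷ x
    apply-q c c↦x = trans (apply-consCoordinate l c) (cong (lookup c l ∷_) c↦x)
    dropHead∘q : ∀ s → apply dropHead (apply q s) ≡ apply p s
    dropHead∘q s = trans (cong (apply dropHead) (apply-consCoordinate l s)) (apply-dropHead _ _)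
    bound : (∃ λ A₁ → A₁ ∈ Π (suc k) × A₁ (lookup c₁ l ∷ x) ≡ true) →
      2 ^ suc r ≤ σ-fiber k A (σ k z)
    bound (A₁ , A₁∈ , A₁c₁) = begin
      2 ^ suc r            ≤⟨ dropHead-fiber-growth r m≡ A₁∈ differ A₁c₁ A₁c₂ ⟩
      fiber dropHead A₁ x  ≡⟨ P2 (suc k) k rk₁ rk A₁ A A₁∈ A∈ dropHead x z Ax Az ⟩
      fiber dropHead A₁ z  ≤⟨ fiber-≤-of-onto q dropHead p onto dropHead∘q z ⟩
      fiber p C z          ≤⟨ fiber-dropFirst-≤-σ-fiber k' C⇒A z ⟩
      σ-fiber k A (σ k z)  ∎
      where
      open ≤-Reasoning
      onto : MapsOnto q C A₁
      onto = mapsOnto-of-hit rC rk₁ C∈ A₁∈ q Cc₁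
        (subst (λ t → A₁ t ≡ true) (sym (apply-q c₁ c₁↦x)) A₁c₁)
      A₁c₂ : A₁ (lookup c₂ l ∷ x) ≡ true
      A₁c₂ = subst (λ t → A₁ t ≡ true) (apply-q c₂ c₂↦x) (proj₁ onto c₂ Cc₂)

  σ-fibers-large : ∀ r {k'} → m ≡ r + suc (suc k') → InRange m (k' + suc k') →
    ∀ {A} → A ∈ Π (suc k') → ∀ {x u w} → A x ≡ true → A (u ∷ w) ≡ true →
    x ≢ u ∷ w → σ (suc k') x ≡ σ (suc k') (u ∷ w) →
    ∀ z → A z ≡ true → 2 ^ suc r ≤ σ-fiber (suc k') A (σ (suc k') z)
  σ-fibers-large r {k'} m≡ rC {A} A∈ {x} {u} {w} Ax Auw x≢uw σ≡ =
    collision (cover _ rC (w ++ x) (All-++⁺ (All.tail (block-⊆-S rk A∈ Auw)) (block-⊆-S rk A∈ Ax)))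
    where
    k : ℕ
    k = suc k'
    p : LinMap (k' + k) k
    p = dropFirst k' k
    g : LinMap (k' + k) k
    g = σ-completion k' k
    rk : InRange m k
    rk = s≤s z≤n , ≤-trans (n≤1+n k) (proj₂ (inRange-of-≡ r m≡))
    g-hit : apply g (w ++ x) ≡ u ∷ w
    g-hit = apply-σ-completion-of-σ≡ u w x (sym σ≡)
    collision : (∃ λ C → C ∈ Π (k' + k) × C (w ++ x) ≡ true) →
      ∀ z → A z ≡ true → 2 ^ suc r ≤ σ-fiber k A (σ k z)
    collision (C , C∈ , Cwx) with 2 ≤? fiber p C x
    ... | yes 2≤ = σ-fibers-large-of-collision r m≡ rC C∈ A∈ C⇒A Ax 2≤
      where
      C⇒A : ∀ c → C c ≡ true → A (apply g c) ≡ true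
      C⇒A = proj₁ (mapsOnto-of-hit rC rk C∈ A∈ g Cwx (subst (λ t → A t ≡ true) (sym g-hit) Auw))
    ... | no 2≰ = ⊥-elim (x≢uw
      (images-agree rC rk C∈ A∈ p g Cwx (apply-dropFirst w x) g-hit Ax Auw (s≤s⁻¹ (≰⇒> 2≰))))

  σ-injective : ∀ {k} → InRange m k → 2 * k ≤ m → ∀ {A} → A ∈ Π k →
    card k A < 2 ^ (m ∸ k) * cardV (σImage k A) → InjOn A (σ k)
  σ-injective {suc k'} rk 2k≤m {A} A∈ small x (u ∷ w) Ax Auw σ≡ with x ≟ₜ (u ∷ w)
  ... | yes x≡uw = x≡uw
  ... | no x≢uw = ⊥-elim (<⇒≱ small (begin
    2 ^ (m ∸ k) * cardV (σImage k A)
      ≡⟨ cong (λ e → 2 ^ e * cardV (σImage k A)) (m∸n≡1+[m∸1+n] k<m) ⟩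
    2 ^ suc r * cardV (σImage k A)
      ≤⟨ Vectors.*-count-image-≤ (allT k) A (σ k) (2 ^ suc r)
           (σ-fibers-large r m≡ rC A∈ Ax Auw x≢uw σ≡) ⟩
    card k A
      ∎))
    where
    open ≤-Reasoning
    k : ℕ
    k = suc k'
    k+k≤m : k + k ≤ m
    k+k≤m = subst (_≤ m) (cong (k +_) (+-identityʳ k)) 2k≤m
    k<m : k < m
    k<m = ≤-trans (+-monoˡ-≤ k (s≤s z≤n)) k+k≤m
    r : ℕ
    r = m ∸ suc k
    m≡ : m ≡ r + suc k
    m≡ = sym (m∸n+n≡m k<m)
    rC : InRange m (k' + k)
    rC = ≤-trans (s≤s z≤n) (m≤n+m k k') , ≤-trans (+-monoˡ-≤ k (n≤1+n k')) k+k≤m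

lemma4p6 : (F : FiniteField) (n m : ℕ) →
    let open Over F n in
    (S : Vsp → Bool) (Π : Scheme) →
    IsLinearScheme m S Π → StronglyAntisymmetric m Π →
    (k : ℕ) → InRange m k → (A : Subset k) → A ∈ Π k →
    2 * k ≤ m →
    card k A < 2 ^ (m ∸ k) * cardV (σImage k A) →
    InjOn A (σ k) × cardV (σImage k A) ≡ card k A
lemma4p6 F n m S Π isLinear antisymmetric k rk A A∈ 2k≤m small =
  injective , Vectors.count-image-≡-of-injective (allT k) (allT-unique k) A (σ k) injective
  where
  open Over F n using (σ; allT; InjOn)
  open LinearScheme F n m S Π isLinear antisymmetric
  injective : InjOn A (σ k)
  injective = σ-injective rk 2k≤m A∈ small
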